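{- Let $\Gamma=(V,E,o,t)$ be a nonempty locally finite graph with modulus $\mathfrak{m}$ given by $\rho\colon I\to V$. Then $\iota_{\mathfrak m}(\mathrm{Prin}_{\mathfrak m}(\Gamma))\subset\widehat{\mathrm{Prin}}_{\mathfrak m}(\Gamma)$, inducing homomorphisms $\mathrm{Cl}_{\mathfrak m}(\Gamma)\to\widehat{\mathrm{Cl}}_{\mathfrak m}(\Gamma)$ and, for $\Gamma$ connected, $\mathrm{Cl}^0_{\mathfrak m}(\Gamma)\to\widehat{\mathrm{Cl}}{}^0_{\mathfrak m}(\Gamma)$. Both maps are isomorphisms if $\Gamma$ is finite.
   Context: Graph: $V\ne\emptyset$, $E$, $o,t\colon E\to V$, locally finite, countable. A modulus is a nonempty family $(w_i)_{i\in I}$ of vertices, i.e. a map $\rho\colon I\to V$, $\rho(i)=w_i$, with each $I(v)=\rho^{ -1}(v)$ finite. $\partial^*\colon\mathbb{Z}[V]\to\mathbb{Z}[E]$, $v\mapsto\sum_{t(e)=v}e-\sum_{o(e)=v}e$; $\partial=t-o$; $\Delta_0=\partial\partial^*$. $d\colon\mathbb{Z}^V\to\mathbb{Z}^E$, $(df)(e)=f(t(e))-f(o(e))$; $d^*\colon\mathbb{Z}^E\to\mathbb{Z}^V$, $(d^*\omega)(v)=\sum_{t(e)=v}\omega(e)-\sum_{o(e)=v}\omega(e)$; $\square_0=d^*d$. $\mathrm{Div}_{\mathfrak m}=\mathbb{Z}[V]\oplus\mathbb{Z}[I]$, $\mathrm{Div}^0_{\mathfrak m}=\mathbb{Z}[V]_0\oplus\mathbb{Z}[I]$;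 $\mathrm{Prin}_{\mathfrak m}$ is the image of $\mathbb{Z}[V]\to\mathrm{Div}_{\mathfrak m}$, $v\mapsto(\Delta_0(v),\sum_{i\in I(v)}i)$; $\mathrm{Cl}_{\mathfrak m}=\mathrm{Div}_{\mathfrak m}/\mathrm{Prin}_{\mathfrak m}$, $\mathrm{Cl}^0_{\mathfrak m}=\mathrm{Div}^0_{\mathfrak m}/\mathrm{Prin}_{\mathfrak m}$. $\widehat{\mathrm{Div}}_{\mathfrak m}=\mathbb{Z}^V\oplus\mathbb{Z}^I$, $\widehat{\mathrm{Div}}{}^0_{\mathfrak m}=\operatorname{im}(d^*)\oplus\mathbb{Z}^I$; $\widehat{\mathrm{Prin}}_{\mathfrak m}=\{(\square_0f,f\circ\rho):f\in\mathbb{Z}^V\}$; $\widehat{\mathrm{Cl}}_{\mathfrak m}=\widehat{\mathrm{Div}}_{\mathfrak m}/\widehat{\mathrm{Prin}}_{\mathfrak m}$, $\widehat{\mathrm{Cl}}{}^0_{\mathfrak m}=\widehat{\mathrm{Div}}{}^0_{\mathfrak m}/\widehat{\mathrm{Prin}}_{\mathfrak m}$. $\iota_{\mathfrak m}\colon\mathrm{Div}_{\mathfrak m}\to\widehat{\mathrm{Div}}_{\mathfrak m}$ is the direct sum of the map $\mathbb{Z}[V]\to\mathbb{Z}^V$ sending a vertex to its characteristic function and the inclusion $\mathbb{Z}[I]\hookrightarrow\mathbb{Z}^I$. -}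

module Defs where

open import Data.Nat using (ℕ)
open import Data.Integer using (ℤ; _+_; _-_; _*_; -_; 0ℤ; 1ℤ)
open import Data.List using (List; []; _∷_; map; _++_; foldr)
open import Data.List.Membership.Propositional using (_∈_)
open import Data.List.Relation.Unary.Unique.Propositional using (Unique)
open import Data.Product using (Σ; _×_; _,_; proj₁; proj₂)
open import Function using (_∘_)
open import Function.Bundles using (_⇔_)
open import Function.Definitions using (Injective)
open import Relation.Binary.PropositionalEquality using (_≡_; refl; cong)
open import Relation.Binary.Definitions using (DecidableEquality)
open import Relation.Nullary using (yes; no)
import Data.Nat.Properties as ℕP

record Countable (X : Set) : Set where
  field
    enc     : X → ℕ
    enc-inj : Injective _≡_ _≡_ enc

decEqOf : {X : Set} → Countable X → DecidableEquality X
decEqOf c x y with ℕP._≟_ (Countable.enc c x) (Countable.enc c y)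
... | yes p = yes (Countable.enc-inj c p)
... | no ¬p = no (λ q → ¬p (cong (Countable.enc c) q))

record Graph : Set₁ where
  field
    V E      : Set
    o t      : E → V
    vertex   : V
    countV   : Countable V
    countE   : Countable E
    -- local finiteness: for each v the edges with t(e)=v, resp. o(e)=v,
    -- form a finite set, enumerated without repetition
    inE      : V → List E
    inE-spec : ∀ v e → (e ∈ inE v) ⇔ (t e ≡ v)
    inE-uniq : ∀ v → Unique (inE v)
    outE      : V → List E
    outE-spec : ∀ v e → (e ∈ outE v) ⇔ (o e ≡ v)
    outE-uniq : ∀ v → Unique (outE v)

record Modulus (Γ : Graph) : Set₁ where
  open Graph Γ
  field
    I         : Set
    ρ         : I → V
    index     : I
    countI    : Countable I
    fib       : V → List I
    fib-spec  : ∀ v i → (i ∈ fib v) ⇔ (ρ i ≡ v)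
    fib-uniq  : ∀ v → Unique (fib v)

-- Free abelian groups ℤ[X] as formal sums Σ aₓ x (lists of (coefficient,
-- generator)), compared coefficientwise.

FreeAb : Set → Set
FreeAb X = List (ℤ × X)

gen : {X : Set} → X → FreeAb X
gen x = (1ℤ , x) ∷ []

negF : {X : Set} → FreeAb X → FreeAb X
negF = map (λ p → (- proj₁ p , proj₂ p))

scaleF : {X : Set} → ℤ → FreeAb X → FreeAb X
scaleF a = map (λ p → (a * proj₁ p , proj₂ p))

lift : {X Y : Set} → (X → FreeAb Y) → FreeAb X → FreeAb Y
lift φ []            = []
lift φ ((a , x) ∷ D) = scaleF a (φ x) ++ lift φ D

sumℤ : List ℤ → ℤ
sumℤ = foldr _+_ 0ℤ

deg : {X : Set} → FreeAb X → ℤ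
deg D = sumℤ (map proj₁ D)

coeff : {X : Set} → DecidableEquality X → FreeAb X → X → ℤ
coeff _≟_ []            y = 0ℤ
coeff _≟_ ((a , x) ∷ D) y with x ≟ y
... | yes _ = a + coeff _≟_ D y
... | no  _ = coeff _≟_ D y

EqF : {X : Set} → DecidableEquality X → FreeAb X → FreeAb X → Set
EqF _≟_ D D' = ∀ y → coeff _≟_ D y ≡ coeff _≟_ D' y

charFn : {X : Set} → DecidableEquality X → X → X → ℤ
charFn _≟_ x y with x ≟ y
... | yes _ = 1ℤ
... | no  _ = 0ℤ

incl : {X : Set} → DecidableEquality X → FreeAb X → (X → ℤ)
incl _≟_ []            y = 0ℤ
incl _≟_ ((a , x) ∷ D) y = a * charFn _≟_ x y + incl _≟_ D y

module _ (Γ : Graph) where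
  open Graph Γ

  data Path : V → V → Set where
    stop : ∀ {v} → Path v v
    fwd  : ∀ {u w} (e : E) → o e ≡ u → Path (t e) w → Path u w
    bwd  : ∀ {u w} (e : E) → t e ≡ u → Path (o e) w → Path u w

  Connected : Set
  Connected = ∀ v w → Path v w

  record Finite : Set where
    field
      allV    : List V
      allV-complete : ∀ v → v ∈ allV
      allE    : List E
      allE-complete : ∀ e → e ∈ allE

module Divisors (Γ : Graph) (𝔪 : Modulus Γ) where
  open Graph Γ
  open Modulus 𝔪

  _≟V_ : DecidableEquality V
  _≟V_ = decEqOf countV

  _≟I_ : DecidableEquality I
  _≟I_ = decEqOf countI

  ∂* : FreeAb V → FreeAb E
  ∂* = lift (λ v → map (λ e → (1ℤ , e)) (inE v) ++ map (λ e → (- 1ℤ , e)) (outE v))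

  ∂ : FreeAb E → FreeAb V
  ∂ = lift (λ e → (1ℤ , t e) ∷ (- 1ℤ , o e) ∷ [])

  Δ₀ : FreeAb V → FreeAb V
  Δ₀ D = ∂ (∂* D)

  d : (V → ℤ) → (E → ℤ)
  d f e = f (t e) - f (o e)

  d* : (E → ℤ) → (V → ℤ)
  d* ω v = sumℤ (map ω (inE v)) - sumℤ (map ω (outE v))

  □₀ : (V → ℤ) → (V → ℤ)
  □₀ f = d* (d f)

  Div : Set
  Div = FreeAb V × FreeAb I

  _≈D_ : Div → Div → Set
  (D , x) ≈D (D' , x') = EqF _≟V_ D D' × EqF _≟I_ x x'

  _+D_ : Div → Div → Div
  (D , x) +D (D' , x') = (D ++ D' , x ++ x')

  _-D_ : Div → Div → Div
  (D , x) -D (D' , x') = (D ++ negF D' , x ++ negF x')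

  InDiv⁰ : Div → Set
  InDiv⁰ (D , x) = deg D ≡ 0ℤ

  prin : FreeAb V → Div
  prin D = (Δ₀ D , lift (λ v → map (λ i → (1ℤ , i)) (fib v)) D)

  InPrin : Div → Set
  InPrin 𝔇 = Σ (FreeAb V) λ D → prin D ≈D 𝔇

  -- equality in Cl_𝔪 = Div_𝔪 / Prin_𝔪 (and in Cl⁰_𝔪 ⊆ Cl_𝔪)
  _∼_ : Div → Div → Set
  𝔇 ∼ 𝔇' = InPrin (𝔇 -D 𝔇')

  DivH : Set
  DivH = (V → ℤ) × (I → ℤ)

  _≐_ : DivH → DivH → Set
  (F , g) ≐ (F' , g') = (∀ v → F v ≡ F' v) × (∀ i → g i ≡ g' i)

  _+H_ : DivH → DivH → DivH
  (F , g) +H (F' , g') = ((λ v → F v + F' v) , (λ i → g i + g' i))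

  _-H_ : DivH → DivH → DivH
  (F , g) -H (F' , g') = ((λ v → F v - F' v) , (λ i → g i - g' i))

  InDivH⁰ : DivH → Set
  InDivH⁰ (F , g) = Σ (E → ℤ) λ ω → ∀ v → d* ω v ≡ F v

  prinH : (V → ℤ) → DivH
  prinH f = (□₀ f , f ∘ ρ)

  InPrinH : DivH → Set
  InPrinH 𝔉 = Σ (V → ℤ) λ f → prinH f ≐ 𝔉

  -- equality in \hat{Cl}_𝔪 (and in \hat{Cl}⁰_𝔪 ⊆ \hat{Cl}_𝔪)
  _∼H_ : DivH → DivH → Set
  𝔉 ∼H 𝔉' = InPrinH (𝔉 -H 𝔉')

  ι : Div → DivH
  ι (D , x) = (incl _≟V_ D , incl _≟I_ x)

-- ι intertwines the combinatorial operators with their duals: ι ∘ ∂ = d* ∘ ι and ι ∘ ∂* = d ∘ ι,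
-- because ∂, ∂* are the linear extensions of e ↦ t e − o e and v ↦ Σ_{t e = v} e − Σ_{o e = v} e,
-- and summing the characteristic function of x over an enumerated fibre of f gives [f x = y].
-- Hence ι ∘ Δ₀ = □₀ ∘ ι, and likewise for the modulus part, so ι(prin D) = prinH(ι D) and ι
-- descends to the class groups. For a degree-0 divisor on a connected graph, joining every vertex
-- to a base point by a path gives a 1-chain ω with ι D = d* ω. When Γ is finite, every function
-- is ι of a finite formal sum, which gives injectivity and surjectivity.
module Submission where

open import Defs
open import Data.Product using (Σ; _×_; _,_; proj₂)
open import Data.Integer using (ℤ; _+_; _-_; _*_; -_; 0ℤ; 1ℤ)
open import Data.Integer.Properties
  using (+-assoc; +-identityˡ; +-identityʳ; +-inverseʳ; *-identityˡ; *-identityʳ; *-zeroʳ)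
open import Data.Integer.Tactic.RingSolver using (solve-∀)
open import Data.List using (List; []; _∷_; map; _++_; deduplicate; concat)
open import Data.List.Properties using (map-cong)
open import Data.List.Membership.Propositional using (_∈_; _∉_)
open import Data.List.Membership.Propositional.Properties using (∈-deduplicate⁺; ∈-concat⁺′; ∈-map⁺)
open import Data.List.Relation.Unary.Any using (here; there)
open import Data.List.Relation.Unary.All using () renaming (lookup to All-lookup)
open import Data.List.Relation.Unary.AllPairs using (_∷_)
open import Data.List.Relation.Unary.Unique.Propositional using (Unique)
open import Data.List.Relation.Unary.Unique.DecPropositional.Properties using (deduplicate-!)
open import Data.Empty using (⊥-elim)
open import Function.Bundles using (_⇔_; Equivalence)
open import Relation.Binary.Definitions using (DecidableEquality)
open import Relation.Binary.PropositionalEquality using (_≡_; refl; sym; trans; cong; cong₂; module ≡-Reasoning)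
open import Relation.Nullary using (yes; no)

open Equivalence using (to; from)
open ≡-Reasoning

sumℤ-zero : {A : Set} (L : List A) → sumℤ (map (λ _ → 0ℤ) L) ≡ 0ℤ
sumℤ-zero []      = refl
sumℤ-zero (x ∷ L) = trans (+-identityˡ _) (sumℤ-zero L)

sumℤ-lincomb : {A : Set} (a : ℤ) (f g : A → ℤ) (L : List A) →
               sumℤ (map (λ x → a * f x + g x) L) ≡ a * sumℤ (map f L) + sumℤ (map g L)
sumℤ-lincomb a f g []      = sym (trans (+-identityʳ _) (*-zeroʳ a))
sumℤ-lincomb a f g (x ∷ L) =
  trans (cong (a * f x + g x +_) (sumℤ-lincomb a f g L)) (shuffle a (f x) (g x) (sumℤ (map f L)) (sumℤ (map g L)))
  where
  shuffle : ∀ a p q r s → (a * p + q) + (a * r + s) ≡ a * (p + r) + (q + s)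
  shuffle = solve-∀

lincomb-sub : ∀ a p q r s → a * (p - q) + (r - s) ≡ (a * p + r) - (a * q + s)
lincomb-sub = solve-∀

deg-++ : {X : Set} (A B : FreeAb X) → deg (A ++ B) ≡ deg A + deg B
deg-++ []            B = sym (+-identityˡ _)
deg-++ ((a , x) ∷ A) B = trans (cong (a +_) (deg-++ A B)) (sym (+-assoc a _ _))

deg-scaleF : {X : Set} (c : ℤ) (A : FreeAb X) → deg (scaleF c A) ≡ c * deg A
deg-scaleF c []            = sym (*-zeroʳ c)
deg-scaleF c ((a , x) ∷ A) = trans (cong (c * a +_) (deg-scaleF c A)) (distrib c a (deg A))
  where
  distrib : ∀ c a s → c * a + c * s ≡ c * (a + s)
  distrib = solve-∀

deg-lift-∷ : {X Y : Set} (φ : X → FreeAb Y) (a : ℤ) (x : X) (D : FreeAb X) →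
             deg (lift φ ((a , x) ∷ D)) ≡ a * deg (φ x) + deg (lift φ D)
deg-lift-∷ φ a x D = trans (deg-++ (scaleF a (φ x)) (lift φ D)) (cong (_+ deg (lift φ D)) (deg-scaleF a (φ x)))

module FormalSum {X : Set} (_≟_ : DecidableEquality X) where

  χ : X → X → ℤ
  χ = charFn _≟_

  χ-sym : ∀ x y → χ x y ≡ χ y x
  χ-sym x y with x ≟ y | y ≟ x
  ... | yes _   | yes _   = refl
  ... | no _    | no _    = refl
  ... | yes x≡y | no y≢x  = ⊥-elim (y≢x (sym x≡y))
  ... | no x≢y  | yes y≡x = ⊥-elim (x≢y (sym y≡x))

  coeff≡incl : ∀ D y → coeff _≟_ D y ≡ incl _≟_ D y
  coeff≡incl []            y = refl
  coeff≡incl ((a , x) ∷ D) y with x ≟ y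
  ... | yes _ = cong₂ _+_ (sym (*-identityʳ a)) (coeff≡incl D y)
  ... | no _  = trans (coeff≡incl D y) (sym (trans (cong (_+ incl _≟_ D y) (*-zeroʳ a)) (+-identityˡ _)))

  EqF⇒incl : ∀ D D' → EqF _≟_ D D' → ∀ y → incl _≟_ D y ≡ incl _≟_ D' y
  EqF⇒incl D D' D≈D' y = trans (sym (coeff≡incl D y)) (trans (D≈D' y) (coeff≡incl D' y))

  incl⇒EqF : ∀ D D' → (∀ y → incl _≟_ D y ≡ incl _≟_ D' y) → EqF _≟_ D D'
  incl⇒EqF D D' ιD≡ιD' y = trans (coeff≡incl D y) (trans (ιD≡ιD' y) (sym (coeff≡incl D' y)))

  incl-++ : ∀ A B y → incl _≟_ (A ++ B) y ≡ incl _≟_ A y + incl _≟_ B y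
  incl-++ []            B y = sym (+-identityˡ _)
  incl-++ ((a , x) ∷ A) B y =
    trans (cong (a * χ x y +_) (incl-++ A B y)) (sym (+-assoc (a * χ x y) (incl _≟_ A y) (incl _≟_ B y)))

  incl-scaleF : ∀ c A y → incl _≟_ (scaleF c A) y ≡ c * incl _≟_ A y
  incl-scaleF c []            y = sym (*-zeroʳ c)
  incl-scaleF c ((a , x) ∷ A) y = trans (cong (c * a * χ x y +_) (incl-scaleF c A y)) (distrib c a (χ x y) (incl _≟_ A y))
    where
    distrib : ∀ c a u s → c * a * u + c * s ≡ c * (a * u + s)
    distrib = solve-∀

  incl-negF : ∀ A y → incl _≟_ (negF A) y ≡ - incl _≟_ A y
  incl-negF []            y = refl
  incl-negF ((a , x) ∷ A) y = trans (cong (- a * χ x y +_) (incl-negF A y)) (distrib a (χ x y) (incl _≟_ A y))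
    where
    distrib : ∀ a u s → - a * u + - s ≡ - (a * u + s)
    distrib = solve-∀

  incl-sub : ∀ A B y → incl _≟_ (A ++ negF B) y ≡ incl _≟_ A y - incl _≟_ B y
  incl-sub A B y = trans (incl-++ A (negF B) y) (cong (incl _≟_ A y +_) (incl-negF B y))

  incl-lift-∷ : {W : Set} (φ : W → FreeAb X) (a : ℤ) (w : W) (D : FreeAb W) (y : X) →
                incl _≟_ (lift φ ((a , w) ∷ D)) y ≡ a * incl _≟_ (φ w) y + incl _≟_ (lift φ D) y
  incl-lift-∷ φ a w D y =
    trans (incl-++ (scaleF a (φ w)) (lift φ D) y) (cong (_+ incl _≟_ (lift φ D) y) (incl-scaleF a (φ w) y))

  linComb : (X → ℤ) → List X → FreeAb X
  linComb h L = map (λ x → (h x , x)) L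

  incl-linComb-∉ : ∀ h L {y} → y ∉ L → incl _≟_ (linComb h L) y ≡ 0ℤ
  incl-linComb-∉ h []      y∉L = refl
  incl-linComb-∉ h (x ∷ L) {y} y∉L with x ≟ y
  ... | yes refl = ⊥-elim (y∉L (here refl))
  ... | no _     = trans (cong (_+ incl _≟_ (linComb h L) y) (*-zeroʳ (h x)))
                         (trans (+-identityˡ _) (incl-linComb-∉ h L (λ y∈L → y∉L (there y∈L))))

  incl-linComb-∈ : ∀ h L {y} → Unique L → y ∈ L → incl _≟_ (linComb h L) y ≡ h y
  incl-linComb-∈ h (x ∷ L) (x∉L ∷ _) (here refl) with x ≟ x
  ... | yes _   = trans (cong₂ _+_ (*-identityʳ (h x)) (incl-linComb-∉ h L (λ x∈L → All-lookup x∉L x∈L refl)))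
                        (+-identityʳ (h x))
  ... | no x≢x  = ⊥-elim (x≢x refl)
  incl-linComb-∈ h (x ∷ L) {y} (x∉L ∷ L-unique) (there y∈L) with x ≟ y
  ... | yes refl = ⊥-elim (All-lookup x∉L y∈L refl)
  ... | no _     = trans (cong (_+ incl _≟_ (linComb h L) y) (*-zeroʳ (h x)))
                         (trans (+-identityˡ _) (incl-linComb-∈ h L L-unique y∈L))

  sum-χ≡incl : ∀ x L → sumℤ (map (χ x) L) ≡ incl _≟_ (linComb (λ _ → 1ℤ) L) x
  sum-χ≡incl x []       = refl
  sum-χ≡incl x (x' ∷ L) = cong₂ _+_ (trans (χ-sym x x') (sym (*-identityˡ _))) (sum-χ≡incl x L)

  fromFunction : List X → (X → ℤ) → FreeAb X
  fromFunction L h = linComb h (deduplicate _≟_ L)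

  incl-fromFunction : ∀ {L} → (∀ x → x ∈ L) → ∀ h y → incl _≟_ (fromFunction L h) y ≡ h y
  incl-fromFunction {L} complete h y =
    incl-linComb-∈ h (deduplicate _≟_ L) (deduplicate-! _≟_ L) (∈-deduplicate⁺ _≟_ (complete y))

module Fibre {X Y : Set} (_≟X_ : DecidableEquality X) (_≟Y_ : DecidableEquality Y)
             (f : X → Y) (y : Y) (L : List X) (L-unique : Unique L) (L-fibre : ∀ x → (x ∈ L) ⇔ (f x ≡ y)) where

  open FormalSum _≟X_

  incl-fibre : ∀ c x → incl _≟X_ (linComb (λ _ → c) L) x ≡ c * charFn _≟Y_ y (f x)
  incl-fibre c x with y ≟Y f x
  ... | yes y≡fx = trans (incl-linComb-∈ (λ _ → c) L L-unique (from (L-fibre x) (sym y≡fx))) (sym (*-identityʳ c))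
  ... | no y≢fx  = trans (incl-linComb-∉ (λ _ → c) L (λ x∈L → y≢fx (sym (to (L-fibre x) x∈L)))) (sym (*-zeroʳ c))

  sum-χ-fibre : ∀ x → sumℤ (map (χ x) L) ≡ charFn _≟Y_ (f x) y
  sum-χ-fibre x = trans (sum-χ≡incl x L)
                 (trans (incl-fibre 1ℤ x) (trans (*-identityˡ _) (FormalSum.χ-sym _≟Y_ y (f x))))

module Comparison (Γ : Graph) (𝔪 : Modulus Γ) where
  open Graph Γ
  open Modulus 𝔪
  open Divisors Γ 𝔪

  _≟E_ : DecidableEquality E
  _≟E_ = decEqOf countE

  module FV = FormalSum _≟V_
  module FE = FormalSum _≟E_
  module FI = FormalSum _≟I_
  module In  (v : V) = Fibre _≟E_ _≟V_ t v (inE v) (inE-uniq v) (inE-spec v)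
  module Out (v : V) = Fibre _≟E_ _≟V_ o v (outE v) (outE-uniq v) (outE-spec v)
  module Fib (v : V) = Fibre _≟I_ _≟V_ ρ v (fib v) (fib-uniq v) (fib-spec v)

  χV : V → V → ℤ
  χV = charFn _≟V_

  χE : E → E → ℤ
  χE = charFn _≟E_

  d*-cong : ∀ {ω ω' : E → ℤ} → (∀ e → ω e ≡ ω' e) → ∀ v → d* ω v ≡ d* ω' v
  d*-cong ω≡ω' v = cong₂ _-_ (cong sumℤ (map-cong ω≡ω' (inE v))) (cong sumℤ (map-cong ω≡ω' (outE v)))

  d*-zero : ∀ v → d* (λ _ → 0ℤ) v ≡ 0ℤ
  d*-zero v = cong₂ _-_ (sumℤ-zero (inE v)) (sumℤ-zero (outE v))

  d*-lincomb : ∀ a (ω ω' : E → ℤ) v → d* (λ e → a * ω e + ω' e) v ≡ a * d* ω v + d* ω' v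
  d*-lincomb a ω ω' v = begin
    d* (λ e → a * ω e + ω' e) v
      ≡⟨ cong₂ _-_ (sumℤ-lincomb a ω ω' (inE v)) (sumℤ-lincomb a ω ω' (outE v)) ⟩
    (a * sumℤ (map ω (inE v)) + sumℤ (map ω' (inE v))) - (a * sumℤ (map ω (outE v)) + sumℤ (map ω' (outE v)))
      ≡⟨ sym (lincomb-sub a _ _ _ _) ⟩
    a * d* ω v + d* ω' v ∎

  d-lincomb : ∀ a (f g : V → ℤ) e → d (λ u → a * f u + g u) e ≡ a * d f e + d g e
  d-lincomb a f g e = sym (lincomb-sub a (f (t e)) (f (o e)) (g (t e)) (g (o e)))

  d*-χE : ∀ e v → d* (χE e) v ≡ χV (t e) v - χV (o e) v
  d*-χE e v = cong₂ _-_ (In.sum-χ-fibre v e) (Out.sum-χ-fibre v e)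

  incl-∂-edge : ∀ e v → incl _≟V_ ((1ℤ , t e) ∷ (- 1ℤ , o e) ∷ []) v ≡ d* (χE e) v
  incl-∂-edge e v = trans (signed-pair (χV (t e) v) (χV (o e) v)) (sym (d*-χE e v))
    where
    signed-pair : ∀ p q → 1ℤ * p + (- 1ℤ * q + 0ℤ) ≡ p - q
    signed-pair = solve-∀

  incl-∂*-vertex : ∀ v e →
    incl _≟E_ (map (λ e → (1ℤ , e)) (inE v) ++ map (λ e → (- 1ℤ , e)) (outE v)) e ≡ d (χV v) e
  incl-∂*-vertex v e =
    trans (FE.incl-++ (map (λ e → (1ℤ , e)) (inE v)) (map (λ e → (- 1ℤ , e)) (outE v)) e)
          (trans (cong₂ _+_ (In.incl-fibre v 1ℤ e) (Out.incl-fibre v (- 1ℤ) e))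
                 (signed-sum (χV v (t e)) (χV v (o e))))
    where
    signed-sum : ∀ p q → 1ℤ * p + - 1ℤ * q ≡ p - q
    signed-sum = solve-∀

  incl-∂ : ∀ A v → incl _≟V_ (∂ A) v ≡ d* (incl _≟E_ A) v
  incl-∂ []            v = sym (d*-zero v)
  incl-∂ ((a , e) ∷ A) v = begin
    incl _≟V_ (∂ ((a , e) ∷ A)) v
      ≡⟨ FV.incl-lift-∷ _ a e A v ⟩
    a * incl _≟V_ ((1ℤ , t e) ∷ (- 1ℤ , o e) ∷ []) v + incl _≟V_ (∂ A) v
      ≡⟨ cong₂ (λ p q → a * p + q) (incl-∂-edge e v) (incl-∂ A v) ⟩
    a * d* (χE e) v + d* (incl _≟E_ A) v
      ≡⟨ sym (d*-lincomb a (χE e) (incl _≟E_ A) v) ⟩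
    d* (incl _≟E_ ((a , e) ∷ A)) v ∎

  incl-∂* : ∀ D e → incl _≟E_ (∂* D) e ≡ d (incl _≟V_ D) e
  incl-∂* []            e = refl
  incl-∂* ((a , v) ∷ D) e = begin
    incl _≟E_ (∂* ((a , v) ∷ D)) e
      ≡⟨ FE.incl-lift-∷ _ a v D e ⟩
    a * incl _≟E_ (map (λ e → (1ℤ , e)) (inE v) ++ map (λ e → (- 1ℤ , e)) (outE v)) e + incl _≟E_ (∂* D) e
      ≡⟨ cong₂ (λ p q → a * p + q) (incl-∂*-vertex v e) (incl-∂* D e) ⟩
    a * d (χV v) e + d (incl _≟V_ D) e
      ≡⟨ sym (d-lincomb a (χV v) (incl _≟V_ D) e) ⟩
    d (incl _≟V_ ((a , v) ∷ D)) e ∎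

  incl-Δ₀ : ∀ D v → incl _≟V_ (Δ₀ D) v ≡ □₀ (incl _≟V_ D) v
  incl-Δ₀ D v = trans (incl-∂ (∂* D) v) (d*-cong (incl-∂* D) v)

  incl-modulus : ∀ D i → incl _≟I_ (proj₂ (prin D)) i ≡ incl _≟V_ D (ρ i)
  incl-modulus []            i = refl
  incl-modulus ((a , v) ∷ D) i =
    trans (FI.incl-lift-∷ _ a v D i)
          (cong₂ (λ p q → a * p + q) (trans (Fib.incl-fibre v 1ℤ i) (*-identityˡ _)) (incl-modulus D i))

  ≐-sym : ∀ {𝔉 𝔉'} → 𝔉 ≐ 𝔉' → 𝔉' ≐ 𝔉
  ≐-sym (p , q) = (λ v → sym (p v)) , (λ i → sym (q i))

  ≐-trans : ∀ {𝔉 𝔉' 𝔉''} → 𝔉 ≐ 𝔉' → 𝔉' ≐ 𝔉'' → 𝔉 ≐ 𝔉''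
  ≐-trans (p , q) (p' , q') = (λ v → trans (p v) (p' v)) , (λ i → trans (q i) (q' i))

  ≐⇒∼H : ∀ {𝔉 𝔉'} → 𝔉 ≐ 𝔉' → 𝔉 ∼H 𝔉'
  ≐⇒∼H {F , g} {F' , g'} (p , q) =
    (λ _ → 0ℤ) , (λ v → trans (d*-zero v) (sym (vanish (p v)))) , (λ i → sym (vanish (q i)))
    where
    vanish : ∀ {a b} → a ≡ b → a - b ≡ 0ℤ
    vanish {b = b} refl = +-inverseʳ b

  prinH-cong : ∀ {f f' : V → ℤ} → (∀ v → f v ≡ f' v) → prinH f ≐ prinH f'
  prinH-cong f≡f' = d*-cong (λ e → cong₂ _-_ (f≡f' (t e)) (f≡f' (o e))) , (λ i → f≡f' (ρ i))

  ι-prin : ∀ D → ι (prin D) ≐ prinH (incl _≟V_ D)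
  ι-prin D = incl-Δ₀ D , incl-modulus D

  ι-+ : ∀ 𝔇 𝔇' → ι (𝔇 +D 𝔇') ≐ (ι 𝔇 +H ι 𝔇')
  ι-+ (D , x) (D' , x') = FV.incl-++ D D' , FI.incl-++ x x'

  ι-sub : ∀ 𝔇 𝔇' → ι (𝔇 -D 𝔇') ≐ (ι 𝔇 -H ι 𝔇')
  ι-sub (D , x) (D' , x') = FV.incl-sub D D' , FI.incl-sub x x'

  ι-cong : ∀ 𝔇 𝔇' → 𝔇 ≈D 𝔇' → ι 𝔇 ≐ ι 𝔇'
  ι-cong (D , x) (D' , x') (p , q) = FV.EqF⇒incl D D' p , FI.EqF⇒incl x x' q

  ι-injective : ∀ 𝔇 𝔇' → ι 𝔇 ≐ ι 𝔇' → 𝔇 ≈D 𝔇'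
  ι-injective (D , x) (D' , x') (p , q) = FV.incl⇒EqF D D' p , FI.incl⇒EqF x x' q

  ι-prin⊆prinH : ∀ D → InPrinH (ι (prin D))
  ι-prin⊆prinH D = incl _≟V_ D , ≐-sym (ι-prin D)

  ι-respects-∼ : ∀ 𝔇 𝔇' → 𝔇 ∼ 𝔇' → ι 𝔇 ∼H ι 𝔇'
  ι-respects-∼ 𝔇 𝔇' (D , prinD≈) =
    incl _≟V_ D , ≐-trans (≐-sym (ι-prin D)) (≐-trans (ι-cong (prin D) (𝔇 -D 𝔇') prinD≈) (ι-sub 𝔇 𝔇'))

  pathChain : ∀ {u w} → Path Γ u w → FreeAb E
  pathChain stop          = []
  pathChain (fwd e _ P) = (1ℤ , e) ∷ pathChain P
  pathChain (bwd e _ P) = (- 1ℤ , e) ∷ pathChain P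

  d*-pathChain : ∀ {u w} (P : Path Γ u w) v → d* (incl _≟E_ (pathChain P)) v ≡ χV w v - χV u v
  d*-pathChain P v = trans (sym (incl-∂ (pathChain P) v)) (incl-∂-pathChain P)
    where
    telescope : ∀ p q r → 1ℤ * p + (- 1ℤ * q + (r - p)) ≡ r - q
    telescope = solve-∀
    telescope⁻ : ∀ p q r → - 1ℤ * p + (1ℤ * q + (r - q)) ≡ r - p
    telescope⁻ = solve-∀
    incl-∂-pathChain : ∀ {u w} (P : Path Γ u w) → incl _≟V_ (∂ (pathChain P)) v ≡ χV w v - χV u v
    incl-∂-pathChain {u} stop = sym (+-inverseʳ (χV u v))
    incl-∂-pathChain {w = w} (fwd e refl P) =
      trans (cong (λ r → 1ℤ * χV (t e) v + (- 1ℤ * χV (o e) v + r)) (incl-∂-pathChain P))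
            (telescope (χV (t e) v) (χV (o e) v) (χV w v))
    incl-∂-pathChain {w = w} (bwd e refl P) =
      trans (cong (λ r → - 1ℤ * χV (t e) v + (1ℤ * χV (o e) v + r)) (incl-∂-pathChain P))
            (telescope⁻ (χV (t e) v) (χV (o e) v) (χV w v))

  spanningChain : (∀ y → Path Γ vertex y) → FreeAb V → FreeAb E
  spanningChain γ = lift (λ y → pathChain (γ y))

  d*-spanningChain : ∀ γ D v →
    d* (incl _≟E_ (spanningChain γ D)) v ≡ incl _≟V_ D v - deg D * χV vertex v
  d*-spanningChain γ []            v = d*-zero v
  d*-spanningChain γ ((a , y) ∷ D) v = begin
    d* (incl _≟E_ (spanningChain γ ((a , y) ∷ D))) v
      ≡⟨ d*-cong (FE.incl-lift-∷ _ a y D) v ⟩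
    d* (λ e → a * incl _≟E_ (pathChain (γ y)) e + incl _≟E_ (spanningChain γ D) e) v
      ≡⟨ d*-lincomb a _ _ v ⟩
    a * d* (incl _≟E_ (pathChain (γ y))) v + d* (incl _≟E_ (spanningChain γ D)) v
      ≡⟨ cong₂ (λ p q → a * p + q) (d*-pathChain (γ y) v) (d*-spanningChain γ D v) ⟩
    a * (χV y v - χV vertex v) + (incl _≟V_ D v - deg D * χV vertex v)
      ≡⟨ regroup a (χV y v) (χV vertex v) (incl _≟V_ D v) (deg D) ⟩
    incl _≟V_ ((a , y) ∷ D) v - deg ((a , y) ∷ D) * χV vertex v ∎
    where
    regroup : ∀ a p b s n → a * (p - b) + (s - n * b) ≡ (a * p + s) - (a + n) * b
    regroup = solve-∀

  ι-Div⁰ : Connected Γ → ∀ 𝔇 → InDiv⁰ 𝔇 → InDivH⁰ (ι 𝔇)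
  ι-Div⁰ connected (D , x) deg≡0 = incl _≟E_ (spanningChain (connected vertex) D) , λ v →
    trans (d*-spanningChain (connected vertex) D v)
          (trans (cong (λ n → incl _≟V_ D v - n * χV vertex v) deg≡0) (+-identityʳ _))

  deg-∂ : ∀ A → deg (∂ A) ≡ 0ℤ
  deg-∂ []            = refl
  deg-∂ ((a , e) ∷ A) = trans (deg-lift-∷ _ a e A) (cong₂ _+_ (*-zeroʳ a) (deg-∂ A))

  module Finiteness (finite : Finite Γ) where
    open Finite finite

    allI : List I
    allI = concat (map fib allV)

    allI-complete : ∀ i → i ∈ allI
    allI-complete i = ∈-concat⁺′ (from (fib-spec (ρ i) i) refl) (∈-map⁺ fib (allV-complete (ρ i)))

    divisorOf : DivH → Div
    divisorOf (F , g) = FV.fromFunction allV F , FI.fromFunction allI g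

    ι-divisorOf : ∀ 𝔉 → ι (divisorOf 𝔉) ≐ 𝔉
    ι-divisorOf (F , g) = FV.incl-fromFunction allV-complete F , FI.incl-fromFunction allI-complete g

    ι-reflects-∼ : ∀ 𝔇 𝔇' → ι 𝔇 ∼H ι 𝔇' → 𝔇 ∼ 𝔇'
    ι-reflects-∼ 𝔇 𝔇' (f , prinHf≐) = D , ι-injective (prin D) (𝔇 -D 𝔇') (≐-trans (ι-prin D)
      (≐-trans (prinH-cong (FV.incl-fromFunction allV-complete f)) (≐-trans prinHf≐ (≐-sym (ι-sub 𝔇 𝔇')))))
      where
      D : FreeAb V
      D = FV.fromFunction allV f

    ι-surjective : ∀ 𝔉 → Σ Div λ 𝔇 → ι 𝔇 ∼H 𝔉
    ι-surjective 𝔉 = divisorOf 𝔉 , ≐⇒∼H (ι-divisorOf 𝔉)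

    -- d* ω is ι of the boundary of the 1-chain Σ_e ω(e) e, and boundaries have degree 0.
    ι-surjective⁰ : ∀ 𝔉 → InDivH⁰ 𝔉 → Σ Div λ 𝔇 → InDiv⁰ 𝔇 × (ι 𝔇 ∼H 𝔉)
    ι-surjective⁰ (F , g) (ω , d*ω≡F) = (∂ chain , FI.fromFunction allI g) , deg-∂ chain ,
      ≐⇒∼H ((λ v → trans (incl-∂ chain v) (trans (d*-cong (FE.incl-fromFunction allE-complete ω) v) (d*ω≡F v))) ,
            FI.incl-fromFunction allI-complete g)
      where
      chain : FreeAb E
      chain = FE.fromFunction allE ω

proposition3p1p5 : (Γ : Graph) (𝔪 : Modulus Γ) → let open Divisors Γ 𝔪 in
    ((D : FreeAb (Graph.V Γ)) → InPrinH (ι (prin D)))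
    × ((𝔇 𝔇' : Div) → ι (𝔇 +D 𝔇') ≐ (ι 𝔇 +H ι 𝔇'))
    × ((𝔇 𝔇' : Div) → 𝔇 ∼ 𝔇' → ι 𝔇 ∼H ι 𝔇')
    × (Connected Γ → (𝔇 : Div) → InDiv⁰ 𝔇 → InDivH⁰ (ι 𝔇))
    × (Finite Γ →
        ((𝔇 𝔇' : Div) → ι 𝔇 ∼H ι 𝔇' → 𝔇 ∼ 𝔇')
        × ((𝔉 : DivH) → Σ Div λ 𝔇 → ι 𝔇 ∼H 𝔉))
    × (Finite Γ → Connected Γ →
        ((𝔇 𝔇' : Div) → InDiv⁰ 𝔇 → InDiv⁰ 𝔇' → ι 𝔇 ∼H ι 𝔇' → 𝔇 ∼ 𝔇')
        × ((𝔉 : DivH) → InDivH⁰ 𝔉 → Σ Div λ 𝔇 → InDiv⁰ 𝔇 × (ι 𝔇 ∼H 𝔉)))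
proposition3p1p5 Γ 𝔪 =
  ι-prin⊆prinH , ι-+ , ι-respects-∼ , ι-Div⁰ ,
  (λ finite → Finiteness.ι-reflects-∼ finite , Finiteness.ι-surjective finite) ,
  (λ finite _ → (λ 𝔇 𝔇' _ _ → Finiteness.ι-reflects-∼ finite 𝔇 𝔇') , Finiteness.ι-surjective⁰ finite)
  where open Comparison Γ 𝔪
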